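{- Let $a,b,c,d$ be distinct points in a metric space $(V,\rho)$. Then $(a,b,c,d)$ is a parallelogram if and only if $\rho(a,b)=\rho(c,d)$, $\rho(a,d)=\rho(b,c)$, and $\rho(a,c)=\rho(b,d)=\rho(a,b)+\rho(b,c)$.
   Context: For distinct points $p,q,r$ write $[pqr]$ if $\rho(p,r)=\rho(p,q)+\rho(q,r)$. For four distinct points, $(a,b,c,d)$ is a parallelogram if $[abc]$, $[bcd]$, $[cda]$ and $[dab]$ all hold. -}

module Defs where

open import Level using (0ℓ)
open import Data.Product using (Σ; ∃; _×_; _,_)
open import Relation.Nullary using (¬_)
open import Relation.Binary.PropositionalEquality using (_≡_)
open import Relation.Binary.Structures using (IsTotalOrder)
open import Algebra.Core using (Op₁; Op₂)
import Algebra.Structures as AS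

-- The real numbers, axiomatised as a complete ordered field
-- (the standard library has no real numbers; any model of these
-- axioms is isomorphic to ℝ).
record RealNumbers : Set₁ where
  infixl 6 _+_
  infixl 7 _*_
  infix  4 _≤_
  field
    ℝ    : Set
    _+_  : Op₂ ℝ
    _*_  : Op₂ ℝ
    -_   : Op₁ ℝ
    0ℝ   : ℝ
    1ℝ   : ℝ
    _≤_  : ℝ → ℝ → Set
    isCommutativeRing : AS.IsCommutativeRing {A = ℝ} _≡_ _+_ _*_ -_ 0ℝ 1ℝ
    0≢1  : ¬ (0ℝ ≡ 1ℝ)
    inverse : ∀ x → ¬ (x ≡ 0ℝ) → Σ ℝ (λ y → x * y ≡ 1ℝ)
    isTotalOrder : IsTotalOrder _≡_ _≤_
    +-mono-≤ : ∀ x y z → x ≤ y → x + z ≤ y + z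
    *-nonneg : ∀ x y → 0ℝ ≤ x → 0ℝ ≤ y → 0ℝ ≤ x * y
    complete : (S : ℝ → Set) → Σ ℝ S → Σ ℝ (λ u → ∀ x → S x → x ≤ u) →
               Σ ℝ (λ s → (∀ x → S x → x ≤ s) ×
                          (∀ u → (∀ x → S x → x ≤ u) → s ≤ u))

record MetricSpace (R : RealNumbers) : Set₁ where
  open RealNumbers R
  field
    V  : Set
    ρ  : V → V → ℝ
    ρ-nonneg  : ∀ x y → 0ℝ ≤ ρ x y
    ρ-zero⇒≡  : ∀ x y → ρ x y ≡ 0ℝ → x ≡ y
    ρ-self    : ∀ x → ρ x x ≡ 0ℝ
    ρ-sym     : ∀ x y → ρ x y ≡ ρ y x
    ρ-triangle : ∀ x y z → ρ x z ≤ ρ x y + ρ y z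

module _ {R : RealNumbers} (M : MetricSpace R) where
  open RealNumbers R
  open MetricSpace M

  -- [pqr] : ρ(p,r) = ρ(p,q) + ρ(q,r)   (used for distinct p, q, r)
  Between : V → V → V → Set
  Between p q r = ρ p r ≡ ρ p q + ρ q r

  Parallelogram : V → V → V → V → Set
  Parallelogram a b c d =
    Between a b c × Between b c d × Between c d a × Between d a b

  Distinct4 : V → V → V → V → Set
  Distinct4 a b c d =
    ¬ (a ≡ b) × ¬ (a ≡ c) × ¬ (a ≡ d) × ¬ (b ≡ c) × ¬ (b ≡ d) × ¬ (c ≡ d)

-- Going round the quadrilateral, [abc] and [cda] express the diagonal
-- ρ(a,c) in two ways, and [bcd] and [dab] do the same for ρ(b,d). With
-- sides x, y, z, w this gives x + y = z + w and y + z = w + x, hence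
-- 2x = 2z, so opposite sides agree and both diagonals equal x + y.
-- Conversely, equal opposite sides make each of the four betweenness
-- equations a rewriting of one of the two diagonal equations.
module Submission where

open import Level using (0ℓ)
open import Data.Fin using (zero; suc)
open import Data.Product using (_×_; _,_)
open import Data.Sum using (inj₁; inj₂)
open import Data.Vec using ([]; _∷_)
open import Function.Bundles using (_⇔_; mk⇔)
open import Relation.Binary.PropositionalEquality
open import Relation.Binary.Structures using (IsTotalOrder)
open import Algebra.Bundles using (CommutativeRing)
import Algebra.Properties.Group as GroupProperties
import Algebra.Solver.CommutativeMonoid as CommutativeMonoidSolver
open import Defs

module RealNumberProperties (R : RealNumbers) where
  open RealNumbers R
  open IsTotalOrder isTotalOrder using (antisym; total)

  ℝ-commutativeRing : CommutativeRing 0ℓ 0ℓ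
  ℝ-commutativeRing = record { isCommutativeRing = isCommutativeRing }

  open CommutativeRing ℝ-commutativeRing
    using (+-comm; +-group; +-commutativeMonoid)
  open GroupProperties +-group using () renaming (∙-cancelʳ to +-cancelʳ)

  x≤y∧x+x≡y+y⇒x≡y : ∀ {x y} → x ≤ y → x + x ≡ y + y → x ≡ y
  x≤y∧x+x≡y+y⇒x≡y {x} {y} x≤y x+x≡y+y = +-cancelʳ x x y (antisym x+x≤y+x y+x≤x+x)
    where
      x+x≤y+x : x + x ≤ y + x
      x+x≤y+x = +-mono-≤ x y x x≤y
      y+x≤x+x : y + x ≤ x + x
      y+x≤x+x = subst₂ _≤_ (+-comm x y) (sym x+x≡y+y) (+-mono-≤ x y y x≤y)

  x+x≡y+y⇒x≡y : ∀ {x y} → x + x ≡ y + y → x ≡ y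
  x+x≡y+y⇒x≡y {x} {y} e with total x y
  ... | inj₁ x≤y = x≤y∧x+x≡y+y⇒x≡y x≤y e
  ... | inj₂ y≤x = sym (x≤y∧x+x≡y+y⇒x≡y y≤x (sym e))

  x+y≡z+w∧y+z≡w+x⇒x≡z : ∀ {x y z w} → x + y ≡ z + w → y + z ≡ w + x → x ≡ z
  x+y≡z+w∧y+z≡w+x⇒x≡z {x} {y} {z} {w} e₁ e₂ =
    x+x≡y+y⇒x≡y (+-cancelʳ (y + w) (x + x) (z + z) (begin
      (x + x) + (y + w)  ≡⟨ rearrange₁ x y w ⟩
      (x + y) + (w + x)  ≡⟨ cong₂ _+_ e₁ (sym e₂) ⟩
      (z + w) + (y + z)  ≡⟨ rearrange₂ z w y ⟩
      (z + z) + (y + w)  ∎))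
    where
      open ≡-Reasoning
      open CommutativeMonoidSolver +-commutativeMonoid
      rearrange₁ : ∀ a b c → (a + a) + (b + c) ≡ (a + b) + (c + a)
      rearrange₁ a b c = prove 3 ((A ⊕ A) ⊕ (B ⊕ C)) ((A ⊕ B) ⊕ (C ⊕ A)) (a ∷ b ∷ c ∷ [])
        where A = var zero; B = var (suc zero); C = var (suc (suc zero))
      rearrange₂ : ∀ a b c → (a + b) + (c + a) ≡ (a + a) + (c + b)
      rearrange₂ a b c = prove 3 ((A ⊕ B) ⊕ (C ⊕ A)) ((A ⊕ A) ⊕ (C ⊕ B)) (a ∷ b ∷ c ∷ [])
        where A = var zero; B = var (suc zero); C = var (suc (suc zero))

module ParallelogramProperties {R : RealNumbers} (M : MetricSpace R) where
  open RealNumbers R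
  open MetricSpace M
  open RealNumberProperties R
  open CommutativeRing ℝ-commutativeRing using (+-comm)

  OppositeSidesAndDiagonals : V → V → V → V → Set
  OppositeSidesAndDiagonals a b c d =
    ρ a b ≡ ρ c d × ρ a d ≡ ρ b c ×
    ρ a c ≡ ρ a b + ρ b c × ρ b d ≡ ρ a b + ρ b c

  parallelogram⇒oppositeSidesAndDiagonals : ∀ {a b c d} →
    Parallelogram M a b c d → OppositeSidesAndDiagonals a b c d
  parallelogram⇒oppositeSidesAndDiagonals {a} {b} {c} {d} (abc , bcd , cda , dab) =
    ab≡cd , trans (ρ-sym a d) (sym bc≡da) , abc , bd
    where
      diagonal-ac : ρ a b + ρ b c ≡ ρ c d + ρ d a
      diagonal-ac = trans (sym abc) (trans (ρ-sym a c) cda)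
      diagonal-bd : ρ b c + ρ c d ≡ ρ d a + ρ a b
      diagonal-bd = trans (sym bcd) (trans (ρ-sym b d) dab)
      ab≡cd : ρ a b ≡ ρ c d
      ab≡cd = x+y≡z+w∧y+z≡w+x⇒x≡z diagonal-ac diagonal-bd
      bc≡da : ρ b c ≡ ρ d a
      bc≡da = x+y≡z+w∧y+z≡w+x⇒x≡z diagonal-bd (sym diagonal-ac)
      bd : ρ b d ≡ ρ a b + ρ b c
      bd = trans bcd (trans (+-comm (ρ b c) (ρ c d)) (cong (_+ ρ b c) (sym ab≡cd)))

  oppositeSidesAndDiagonals⇒parallelogram : ∀ {a b c d} →
    OppositeSidesAndDiagonals a b c d → Parallelogram M a b c d
  oppositeSidesAndDiagonals⇒parallelogram {a} {b} {c} {d} (ab≡cd , ad≡bc , ac , bd) =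
    ac , bcd , cda , dab
    where
      da≡bc : ρ d a ≡ ρ b c
      da≡bc = trans (ρ-sym d a) ad≡bc
      bcd : ρ b d ≡ ρ b c + ρ c d
      bcd = trans bd (trans (+-comm (ρ a b) (ρ b c)) (cong (ρ b c +_) ab≡cd))
      cda : ρ c a ≡ ρ c d + ρ d a
      cda = trans (ρ-sym c a) (trans ac (cong₂ _+_ ab≡cd (sym da≡bc)))
      dab : ρ d b ≡ ρ d a + ρ a b
      dab = trans (ρ-sym d b) (trans bd (trans (+-comm (ρ a b) (ρ b c)) (cong (_+ ρ a b) (sym da≡bc))))

mainTheorem15 : (R : RealNumbers) (M : MetricSpace R) →
    let open RealNumbers R in
    let open MetricSpace M in
    (a b c d : V) → Distinct4 M a b c d →
    Parallelogram M a b c d ⇔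
      (ρ a b ≡ ρ c d × ρ a d ≡ ρ b c ×
       ρ a c ≡ ρ a b + ρ b c × ρ b d ≡ ρ a b + ρ b c)
mainTheorem15 R M a b c d _ =
  mk⇔ parallelogram⇒oppositeSidesAndDiagonals oppositeSidesAndDiagonals⇒parallelogram
  where open ParallelogramProperties M
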